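{- Let $a,b\in Ag$ with $a\neq b$. For each of the following schemas there are formulas $\varphi,\psi\in\mathrm{Fm}_{\mathsf S}$ whose instance is not derivable in $\mathsf S$: (1) $\neg S_{a,b}\varphi\to S_{a,b}\neg S_{a,b}\varphi$; (2) $\neg S_{a,b}\varphi\to\neg S_{a,b}\neg S_{a,b}\varphi$; (3) $\neg S_{a,b}(\varphi\to\psi)\to(\neg S_{a,b}\varphi\to\neg S_{a,b}\psi)$; (4) $\neg S_{a,b}\neg K_b\varphi$; (5) $\neg S_{a,b}\neg S_{b,a}\varphi$.
   Context: Let $Ag$ be a non-empty finite set of agents (with at least two elements) and $Var$ a countably infinite set of propositional variables. The formulas $\mathrm{Fm}_{\mathsf S}$ are generated by $\varphi::=p\mid\neg\varphi\mid\varphi\land\varphi\mid I_a\varphi\mid K_a\varphi\mid B_a\varphi$ ($p\in Var$, $a\in Ag$), with $\lor,\to$ classical abbreviations. The logic $\mathsf S$ ($\vdash_{\mathsf S}\varphi$ means $\varphi$ is derivable) has as axioms: all classical tautologies; for each $a$ and $\star\in\{K_a,B_a,I_a\}$, $\star(\varphi\to\psi)\to(\star\varphi\to\star\psi)$; $K_a\varphi\to\varphi$; $K_a\varphi\to K_aK_a\varphi$; $B_a\varphi\to\neg B_a\neg\varphi$; $K_a\varphi\to B_a\varphi$; $B_a\varphi\to K_aB_a\varphi$; $I_a\varphi\to\neg I_a\neg\varphi$; $I_a\varphi\to K_aI_a\varphi$; $I_a\varphi\to I_aK_a\varphi$; $I_a\varphi\to I_aI_a\varphi$; rules: modus ponens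 and necessitation for each $K_a,B_a,I_a$. $S_{a,b}\varphi:=K_a\varphi\land B_a\neg K_b\varphi\land I_a(\varphi\land\neg K_b\varphi)$. -}

module Defs where

open import Data.Nat using (ℕ)
open import Data.Fin using (Fin)
open import Data.Bool using (Bool; true; false; not; _∧_)
open import Relation.Binary.PropositionalEquality using (_≡_)

data Fm (n : ℕ) : Set where
  var : ℕ → Fm n
  ¬′_ : Fm n → Fm n
  _∧′_ : Fm n → Fm n → Fm n
  I K B : Fin n → Fm n → Fm n

infixr 6 _∧′_
infixr 4 _⇒_
infix 7 ¬′_

_⇒_ : ∀ {n} → Fm n → Fm n → Fm n
φ ⇒ ψ = ¬′ (φ ∧′ ¬′ ψ)

_∨′_ : ∀ {n} → Fm n → Fm n → Fm n
φ ∨′ ψ = ¬′ (¬′ φ ∧′ ¬′ ψ)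

eval : ∀ {n} → (Fm n → Bool) → Fm n → Bool
eval v (var p)  = v (var p)
eval v (¬′ φ)   = not (eval v φ)
eval v (φ ∧′ ψ) = eval v φ ∧ eval v ψ
eval v (I a φ)  = v (I a φ)
eval v (K a φ)  = v (K a φ)
eval v (B a φ)  = v (B a φ)

Tautology : ∀ {n} → Fm n → Set
Tautology φ = ∀ v → eval v φ ≡ true

data ⊢_ {n : ℕ} : Fm n → Set where
  taut  : ∀ {φ} → Tautology φ → ⊢ φ
  kK    : ∀ a φ ψ → ⊢ (K a (φ ⇒ ψ) ⇒ (K a φ ⇒ K a ψ))
  kB    : ∀ a φ ψ → ⊢ (B a (φ ⇒ ψ) ⇒ (B a φ ⇒ B a ψ))
  kI    : ∀ a φ ψ → ⊢ (I a (φ ⇒ ψ) ⇒ (I a φ ⇒ I a ψ))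
  tK    : ∀ a φ → ⊢ (K a φ ⇒ φ)
  4K    : ∀ a φ → ⊢ (K a φ ⇒ K a (K a φ))
  dB    : ∀ a φ → ⊢ (B a φ ⇒ ¬′ B a (¬′ φ))
  KB    : ∀ a φ → ⊢ (K a φ ⇒ B a φ)
  BKB   : ∀ a φ → ⊢ (B a φ ⇒ K a (B a φ))
  dI    : ∀ a φ → ⊢ (I a φ ⇒ ¬′ I a (¬′ φ))
  IKI   : ∀ a φ → ⊢ (I a φ ⇒ K a (I a φ))
  IIK   : ∀ a φ → ⊢ (I a φ ⇒ I a (K a φ))
  III   : ∀ a φ → ⊢ (I a φ ⇒ I a (I a φ))
  mp    : ∀ {φ ψ} → ⊢ (φ ⇒ ψ) → ⊢ φ → ⊢ ψ
  necK  : ∀ a {φ} → ⊢ φ → ⊢ K a φ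
  necB  : ∀ a {φ} → ⊢ φ → ⊢ B a φ
  necI  : ∀ a {φ} → ⊢ φ → ⊢ I a φ

S : ∀ {n} → Fin n → Fin n → Fm n → Fm n
S a b φ = K a φ ∧′ (B a (¬′ K b φ) ∧′ I a (φ ∧′ ¬′ K b φ))

{-# OPTIONS --safe #-}
module Submission where

-- S is sound for Kripke models in which every agent has accessibility
-- relations for K, B and I satisfying the frame conditions corresponding to
-- its axioms (K a preorder; B serial, contained in K and closed under K on
-- the left; I serial, transitive and closed under K on both sides).  Each of
-- the five schemas, instantiated with the agents 0 and 1, fails at a world of
-- a two-world model for two agents; since such models are finite, both their
-- frame conditions and the failures are decided by evaluation.  An instance
-- for arbitrary agents a ≢ b is the image of the two-agent one under the
-- renaming 0 ↦ a, 1 ↦ b, and this renaming reflects derivability because it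
-- has a left inverse.

open import Defs
open import Data.Nat using (ℕ; _≤_)
open import Data.Fin using (Fin; _≟_)
open import Data.Fin.Patterns using (0F; 1F)
open import Data.Fin.Properties using (all?; any?)
open import Data.Bool using (Bool; true; false; T; not; _∧_; _∨_; if_then_else_)
open import Data.Product using (_×_; _,_; ∃; ∃₂)
open import Data.Vec.Functional using ([]; _∷_)
open import Function using (_∘_)
open import Relation.Nullary using (¬_; Dec; does; yes; no)
open import Relation.Nullary.Decidable
  using (T?; ¬?; _×-dec_; _→-dec_; map′; decidable-stable; dec-true; dec-false;
         True; False; toWitness; toWitnessFalse)
open import Relation.Binary.PropositionalEquality
  using (_≡_; _≢_; refl; sym; trans; cong; cong₂; subst)

variable
  k m n : ℕ
  φ : Fm m

rename : (Fin m → Fin n) → Fm m → Fm n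
rename ρ (var x)  = var x
rename ρ (¬′ φ)   = ¬′ rename ρ φ
rename ρ (φ ∧′ ψ) = rename ρ φ ∧′ rename ρ ψ
rename ρ (I a φ)  = I (ρ a) (rename ρ φ)
rename ρ (K a φ)  = K (ρ a) (rename ρ φ)
rename ρ (B a φ)  = B (ρ a) (rename ρ φ)

eval-rename : (ρ : Fin m → Fin n) (v : Fm n → Bool) (φ : Fm m) →
              eval v (rename ρ φ) ≡ eval (v ∘ rename ρ) φ
eval-rename ρ v (var x)  = refl
eval-rename ρ v (¬′ φ)   = cong not (eval-rename ρ v φ)
eval-rename ρ v (φ ∧′ ψ) = cong₂ _∧_ (eval-rename ρ v φ) (eval-rename ρ v ψ)
eval-rename ρ v (I a φ)  = refl
eval-rename ρ v (K a φ)  = refl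
eval-rename ρ v (B a φ)  = refl

⊢-rename : (ρ : Fin m → Fin n) → ⊢ φ → ⊢ rename ρ φ
⊢-rename ρ (taut {φ} t)  = taut λ v → trans (eval-rename ρ v φ) (t (v ∘ rename ρ))
⊢-rename ρ (kK a φ ψ)    = kK (ρ a) _ _
⊢-rename ρ (kB a φ ψ)    = kB (ρ a) _ _
⊢-rename ρ (kI a φ ψ)    = kI (ρ a) _ _
⊢-rename ρ (tK a φ)      = tK (ρ a) _
⊢-rename ρ (4K a φ)      = 4K (ρ a) _
⊢-rename ρ (dB a φ)      = dB (ρ a) _
⊢-rename ρ (KB a φ)      = KB (ρ a) _
⊢-rename ρ (BKB a φ)     = BKB (ρ a) _
⊢-rename ρ (dI a φ)      = dI (ρ a) _
⊢-rename ρ (IKI a φ)     = IKI (ρ a) _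
⊢-rename ρ (IIK a φ)     = IIK (ρ a) _
⊢-rename ρ (III a φ)     = III (ρ a) _
⊢-rename ρ (mp ⊢φ⇒ψ ⊢φ)  = mp (⊢-rename ρ ⊢φ⇒ψ) (⊢-rename ρ ⊢φ)
⊢-rename ρ (necK a ⊢φ)   = necK (ρ a) (⊢-rename ρ ⊢φ)
⊢-rename ρ (necB a ⊢φ)   = necB (ρ a) (⊢-rename ρ ⊢φ)
⊢-rename ρ (necI a ⊢φ)   = necI (ρ a) (⊢-rename ρ ⊢φ)

rename-cancelˡ : {σ : Fin n → Fin m} {ρ : Fin m → Fin n} →
                 (∀ a → σ (ρ a) ≡ a) → (φ : Fm m) → rename σ (rename ρ φ) ≡ φ
rename-cancelˡ σρ≗id (var x)  = refl
rename-cancelˡ σρ≗id (¬′ φ)   = cong ¬′_ (rename-cancelˡ σρ≗id φ)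
rename-cancelˡ σρ≗id (φ ∧′ ψ) =
  cong₂ _∧′_ (rename-cancelˡ σρ≗id φ) (rename-cancelˡ σρ≗id ψ)
rename-cancelˡ σρ≗id (I a φ)  = cong₂ I (σρ≗id a) (rename-cancelˡ σρ≗id φ)
rename-cancelˡ σρ≗id (K a φ)  = cong₂ K (σρ≗id a) (rename-cancelˡ σρ≗id φ)
rename-cancelˡ σρ≗id (B a φ)  = cong₂ B (σρ≗id a) (rename-cancelˡ σρ≗id φ)

rename-reflects-⊢ : {ρ : Fin m → Fin n} (σ : Fin n → Fin m) →
                    (∀ a → σ (ρ a) ≡ a) → ⊢ rename ρ φ → ⊢ φ
rename-reflects-⊢ σ σρ≗id ⊢ρφ = subst ⊢_ (rename-cancelˡ σρ≗id _) (⊢-rename σ ⊢ρφ)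

separate : Fin n → Fin n → Fin 2
separate b c = if does (c ≟ b) then 1F else 0F

separate-inverseˡ : {a b : Fin n} → a ≢ b → ∀ i → separate b ((a ∷ b ∷ []) i) ≡ i
separate-inverseˡ {a = a} {b} a≢b 0F rewrite dec-false (a ≟ b) a≢b = refl
separate-inverseˡ {a = a} {b} a≢b 1F rewrite dec-true (b ≟ b) refl = refl

BoolRel : ℕ → Set
BoolRel k = Fin k → Fin k → Bool

variable
  R R′ R″ : BoolRel k
  w : Fin k
  P Q : Fin k → Set

record AgentFrame (k : ℕ) : Set where
  field
    Rᴷ Rᴮ Rᴵ : BoolRel k

record Model (k m : ℕ) : Set where
  constructor model
  field
    agent : Fin m → AgentFrame k
    V     : ℕ → Fin k → Bool

Reflexive Serial : BoolRel k → Set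
Reflexive R = ∀ x → T (R x x)
Serial R    = ∀ x → ∃ λ y → T (R x y)

infix 4 _⊆_ _⨾_⊆_ _⊆?_ _⨾_⊆?_

_⊆_ : BoolRel k → BoolRel k → Set
R ⊆ R′ = ∀ x y → T (R x y) → T (R′ x y)

_⨾_⊆_ : BoolRel k → BoolRel k → BoolRel k → Set
R ⨾ R′ ⊆ R″ = ∀ x y z → T (R x y) → T (R′ y z) → T (R″ x z)

reflexive? : (R : BoolRel k) → Dec (Reflexive R)
reflexive? R = all? λ x → T? (R x x)

serial? : (R : BoolRel k) → Dec (Serial R)
serial? R = all? λ x → any? λ y → T? (R x y)

_⊆?_ : (R R′ : BoolRel k) → Dec (R ⊆ R′)
R ⊆? R′ = all? λ x → all? λ y → T? (R x y) →-dec T? (R′ x y)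

_⨾_⊆?_ : (R R′ R″ : BoolRel k) → Dec (R ⨾ R′ ⊆ R″)
R ⨾ R′ ⊆? R″ =
  all? λ x → all? λ y → all? λ z → T? (R x y) →-dec T? (R′ y z) →-dec T? (R″ x z)

record IsSFrame (F : AgentFrame k) : Set where
  constructor isSFrame
  open AgentFrame F
  field
    K-refl   : Reflexive Rᴷ
    K-trans  : Rᴷ ⨾ Rᴷ ⊆ Rᴷ
    B-serial : Serial Rᴮ
    B⊆K      : Rᴮ ⊆ Rᴷ
    KB⊆B     : Rᴷ ⨾ Rᴮ ⊆ Rᴮ
    I-serial : Serial Rᴵ
    KI⊆I     : Rᴷ ⨾ Rᴵ ⊆ Rᴵ
    IK⊆I     : Rᴵ ⨾ Rᴷ ⊆ Rᴵ
    II⊆I     : Rᴵ ⨾ Rᴵ ⊆ Rᴵ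

isSFrame? : (F : AgentFrame k) → Dec (IsSFrame F)
isSFrame? F =
  map′ (λ (r , t , bs , b⊆k , kb , is , ki , ik , ii) → isSFrame r t bs b⊆k kb is ki ik ii)
       (λ (isSFrame r t bs b⊆k kb is ki ik ii) → r , t , bs , b⊆k , kb , is , ki , ik , ii)
       (reflexive? Rᴷ ×-dec (Rᴷ ⨾ Rᴷ ⊆? Rᴷ) ×-dec
        serial? Rᴮ ×-dec (Rᴮ ⊆? Rᴷ) ×-dec (Rᴷ ⨾ Rᴮ ⊆? Rᴮ) ×-dec
        serial? Rᴵ ×-dec (Rᴷ ⨾ Rᴵ ⊆? Rᴵ) ×-dec (Rᴵ ⨾ Rᴷ ⊆? Rᴵ) ×-dec (Rᴵ ⨾ Rᴵ ⊆? Rᴵ))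
  where open AgentFrame F

IsSModel : Model k m → Set
IsSModel M = ∀ a → IsSFrame (Model.agent M a)

isSModel? : (M : Model k m) → Dec (IsSModel M)
isSModel? M = all? λ a → isSFrame? (Model.agent M a)

-- A record rather than a Π-type, so that unification recovers R, w and P.
record □ (R : BoolRel k) (w : Fin k) (P : Fin k → Set) : Set where
  constructor box
  field
    unbox : ∀ v → T (R w v) → P v

□? : (R : BoolRel k) (w : Fin k) → (∀ v → Dec (P v)) → Dec (□ R w P)
□? R w P? = map′ box □.unbox (all? λ v → T? (R w v) →-dec P? v)

□-refl : Reflexive R → □ R w P → P w
□-refl {w = w} refl-R (box □P) = □P w (refl-R w)

□-⊆ : R ⊆ R′ → □ R′ w P → □ R w P
□-⊆ {w = w} R⊆R′ (box □P) = box λ v Rwv → □P v (R⊆R′ w v Rwv)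

□-⨾ : R ⨾ R′ ⊆ R″ → □ R″ w P → □ R w (λ v → □ R′ v P)
□-⨾ {w = w} RR′⊆R″ (box □P) =
  box λ v Rwv → box λ u R′vu → □P u (RR′⊆R″ w v u Rwv R′vu)

□-serial : Serial R → □ R w P → ¬ □ R w (¬_ ∘ P)
□-serial {w = w} serial-R (box □P) (box □¬P) =
  let (v , Rwv) = serial-R w in □¬P v Rwv (□P v Rwv)

□-K : (∀ v → Dec (Q v)) → □ R w (λ v → ¬ (P v × ¬ Q v)) → □ R w P → □ R w Q
□-K Q? (box □P⇒Q) (box □P) =
  box λ v Rwv → decidable-stable (Q? v) λ ¬Qv → □P⇒Q v Rwv (□P v Rwv , ¬Qv)

⇒-intro : {A B : Set} → (A → B) → ¬ (A × ¬ B)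
⇒-intro f (a , ¬b) = ¬b (f a)

from-does-true : {A : Set} (a? : Dec A) → does a? ≡ true → A
from-does-true (yes a) _  = a
from-does-true (no _)  ()

module _ (M : Model k m) where
  open Model M
  open AgentFrame
  open IsSFrame

  infix 4 _⊨_ _⊨?_

  _⊨_ : Fin k → Fm m → Set
  w ⊨ var x   = T (V x w)
  w ⊨ ¬′ φ    = ¬ (w ⊨ φ)
  w ⊨ φ ∧′ ψ  = w ⊨ φ × w ⊨ ψ
  w ⊨ I a φ   = □ (Rᴵ (agent a)) w (_⊨ φ)
  w ⊨ K a φ   = □ (Rᴷ (agent a)) w (_⊨ φ)
  w ⊨ B a φ   = □ (Rᴮ (agent a)) w (_⊨ φ)

  _⊨?_ : ∀ w (φ : Fm m) → Dec (w ⊨ φ)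
  w ⊨? var x  = T? (V x w)
  w ⊨? ¬′ φ   = ¬? (w ⊨? φ)
  w ⊨? φ ∧′ ψ = w ⊨? φ ×-dec w ⊨? ψ
  w ⊨? I a φ  = □? (Rᴵ (agent a)) w (_⊨? φ)
  w ⊨? K a φ  = □? (Rᴷ (agent a)) w (_⊨? φ)
  w ⊨? B a φ  = □? (Rᴮ (agent a)) w (_⊨? φ)

  eval-⊨ : ∀ w (φ : Fm m) → eval (λ χ → does (w ⊨? χ)) φ ≡ does (w ⊨? φ)
  eval-⊨ w (var x)  = refl
  eval-⊨ w (¬′ φ)   = cong not (eval-⊨ w φ)
  eval-⊨ w (φ ∧′ ψ) = cong₂ _∧_ (eval-⊨ w φ) (eval-⊨ w ψ)
  eval-⊨ w (I a φ)  = refl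
  eval-⊨ w (K a φ)  = refl
  eval-⊨ w (B a φ)  = refl

  tautology-sound : Tautology φ → ∀ w → w ⊨ φ
  tautology-sound {φ} taut-φ w =
    from-does-true (w ⊨? φ) (trans (sym (eval-⊨ w φ)) (taut-φ _))

  soundness : IsSModel M → ⊢ φ → ∀ w → w ⊨ φ
  soundness isS (taut {φ} t) = tautology-sound {φ} t
  soundness isS (kK a φ ψ) w = ⇒-intro λ □φ⇒ψ → ⇒-intro (□-K (_⊨? ψ) □φ⇒ψ)
  soundness isS (kB a φ ψ) w = ⇒-intro λ □φ⇒ψ → ⇒-intro (□-K (_⊨? ψ) □φ⇒ψ)
  soundness isS (kI a φ ψ) w = ⇒-intro λ □φ⇒ψ → ⇒-intro (□-K (_⊨? ψ) □φ⇒ψ)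
  soundness isS (tK a φ)   w = ⇒-intro (□-refl (K-refl (isS a)))
  soundness isS (4K a φ)   w = ⇒-intro (□-⨾ (K-trans (isS a)))
  soundness isS (dB a φ)   w = ⇒-intro (□-serial (B-serial (isS a)))
  soundness isS (KB a φ)   w = ⇒-intro (□-⊆ (B⊆K (isS a)))
  soundness isS (BKB a φ)  w = ⇒-intro (□-⨾ (KB⊆B (isS a)))
  soundness isS (dI a φ)   w = ⇒-intro (□-serial (I-serial (isS a)))
  soundness isS (IKI a φ)  w = ⇒-intro (□-⨾ (KI⊆I (isS a)))
  soundness isS (IIK a φ)  w = ⇒-intro (□-⨾ (IK⊆I (isS a)))
  soundness isS (III a φ)  w = ⇒-intro (□-⨾ (II⊆I (isS a)))
  soundness isS (mp {ψ = ψ} ⊢φ⇒ψ ⊢φ) w =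
    decidable-stable (w ⊨? ψ) λ ¬ψ → soundness isS ⊢φ⇒ψ w (soundness isS ⊢φ w , ¬ψ)
  soundness isS (necK a ⊢φ) w = box λ v _ → soundness isS ⊢φ v
  soundness isS (necB a ⊢φ) w = box λ v _ → soundness isS ⊢φ v
  soundness isS (necI a ⊢φ) w = box λ v _ → soundness isS ⊢φ v

countermodel : (M : Model k m) {M-is-S : True (isSModel? M)}
               (w : Fin k) {w⊭φ : False (_⊨?_ M w φ)} → ¬ ⊢ φ
countermodel M {M-is-S} w {w⊭φ} ⊢φ =
  toWitnessFalse w⊭φ (soundness M (toWitness M-is-S) ⊢φ w)

at : Fin k → Fin k → Bool
at v w = does (w ≟ v)

identity full : BoolRel k
identity = at
full _ _ = true

towards : Fin k → BoolRel k
towards v _ = at v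

_∪_ : BoolRel k → BoolRel k → BoolRel k
(R ∪ R′) x y = R x y ∨ R′ x y

omniscient ignorant : AgentFrame k
omniscient = record { Rᴷ = identity ; Rᴮ = identity ; Rᴵ = identity }
ignorant   = record { Rᴷ = full ; Rᴮ = full ; Rᴵ = full }

pointedAt : Fin k → AgentFrame k
pointedAt v = record { Rᴷ = identity ∪ towards v ; Rᴮ = towards v ; Rᴵ = towards v }

p q : Fm m
p = var 0
q = var 1

-- In M₂ and M₃ agent 0 is omniscient and agent 1 ignorant, so that S 0F 1F χ
-- holds exactly at the worlds where χ holds, provided χ fails somewhere.
M₁ M₂ M₃ : Model 2 2
M₁ = model (pointedAt 0F ∷ pointedAt 1F ∷ []) λ _ → at 1F
M₂ = model (omniscient ∷ ignorant ∷ []) λ _ → at 1F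
M₃ = model (omniscient ∷ ignorant ∷ []) λ { 0 _ → false ; _ w → at 1F w }

⊬¬S⇒S¬S : ¬ ⊢ (¬′ S 0F 1F p ⇒ S 0F 1F (¬′ S 0F 1F p))
⊬¬S⇒S¬S = countermodel M₁ 0F

⊬¬S⇒¬S¬S : ¬ ⊢ (¬′ S 0F 1F p ⇒ ¬′ S 0F 1F (¬′ S 0F 1F p))
⊬¬S⇒¬S¬S = countermodel M₂ 0F

⊬¬S-K : ¬ ⊢ (¬′ S 0F 1F (p ⇒ q) ⇒ (¬′ S 0F 1F p ⇒ ¬′ S 0F 1F q))
⊬¬S-K = countermodel M₃ 1F

⊬¬S¬K : ¬ ⊢ (¬′ S 0F 1F (¬′ K 1F p))
⊬¬S¬K = countermodel M₁ 0F

⊬¬S¬S : ¬ ⊢ (¬′ S 0F 1F (¬′ S 1F 0F p))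
⊬¬S¬S = countermodel M₁ 0F

proposition6 : (n : ℕ) → 2 ≤ n → (a b : Fin n) → a ≢ b →
    (∃ λ φ → ¬ (⊢ (¬′ S a b φ ⇒ S a b (¬′ S a b φ))))
    × (∃ λ φ → ¬ (⊢ (¬′ S a b φ ⇒ ¬′ S a b (¬′ S a b φ))))
    × (∃₂ λ φ ψ → ¬ (⊢ (¬′ S a b (φ ⇒ ψ) ⇒ (¬′ S a b φ ⇒ ¬′ S a b ψ))))
    × (∃ λ φ → ¬ (⊢ (¬′ S a b (¬′ K b φ))))
    × (∃ λ φ → ¬ (⊢ (¬′ S a b (¬′ S b a φ))))
proposition6 n _ a b a≢b =
    (p , transfer ⊬¬S⇒S¬S)
  , (p , transfer ⊬¬S⇒¬S¬S)
  , (p , q , transfer ⊬¬S-K)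
  , (p , transfer ⊬¬S¬K)
  , (p , transfer ⊬¬S¬S)
  where
  transfer : {φ : Fm 2} → ¬ ⊢ φ → ¬ ⊢ rename (a ∷ b ∷ []) φ
  transfer ⊬φ = ⊬φ ∘ rename-reflects-⊢ (separate b) (separate-inverseˡ a≢b)
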